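{- Let $T_i$ be a perfect Roman domination stable tree, let $u\in W(T_i)$, and let $T_{i+1}$ be the tree obtained from $T_i$ by adding a new path $v_3v_2v_1$ (on three new vertices) and the edge $uv_3$. Then $T_{i+1}$ is a perfect Roman domination stable tree.
   Context: All graphs are finite and simple. A perfect Roman dominating function (PRDF) on a graph $G=(V,E)$ is a function $f:V\to\{0,1,2\}$ such that every vertex $u$ with $f(u)=0$ is adjacent to exactly one vertex $v$ with $f(v)=2$. Its weight is $w(f)=\sum_{u\in V}f(u)$, and $\gamma_R^p(G)$ is the minimum weight of a PRDF on $G$; a PRDF of weight $\gamma_R^p(G)$ is a $\gamma_R^p$-function of $G$. A graph $G$ is perfect Roman domination stable if $\gamma_R^p(G-v)=\gamma_R^p(G)$ for every vertex $v\in V(G)$. For a tree $T$, $W(T)=\{u\in V(T): f(u)=0 \text{ for every } \gamma_R^p\text{ -function } f \text{ of } T\}$. -}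

module Defs where

open import Data.Nat using (ℕ; zero; suc; _≤_)
open import Data.Fin using (Fin; zero; suc; toℕ; punchIn; _≟_)
open import Data.Bool using (Bool; true; false)
open import Data.List using (List; []; _∷_; _∷ʳ_; length; map; allFin)
open import Data.Nat.ListAction using (sum)
open import Data.List.Relation.Unary.Unique.Propositional using (Unique)
open import Data.Product using (Σ; _×_; _,_; ∃)
open import Data.Unit using (⊤)
open import Data.Empty using (⊥)
open import Relation.Nullary using (¬_; does)
open import Relation.Binary.PropositionalEquality using (_≡_; refl)

record Graph (n : ℕ) : Set where
  field
    adj    : Fin n → Fin n → Bool
    sym    : ∀ i j → adj i j ≡ adj j i
    irrefl : ∀ i → adj i i ≡ false
open Graph public

Adj : ∀ {n} → Graph n → Fin n → Fin n → Set
Adj G i j = adj G i j ≡ true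

data Walk {n} (G : Graph n) : Fin n → Fin n → Set where
  here : ∀ {i} → Walk G i i
  step : ∀ {i j k} → Adj G i j → Walk G j k → Walk G i k

Connected : ∀ {n} → Graph n → Set
Connected G = ∀ i j → Walk G i j

Chain : ∀ {n} → Graph n → List (Fin n) → Set
Chain G []            = ⊤
Chain G (x ∷ [])      = ⊤
Chain G (x ∷ y ∷ xs)  = Adj G x y × Chain G (y ∷ xs)

HasCycle : ∀ {n} → Graph n → Set
HasCycle {n} G = Σ (Fin n) λ x → Σ (List (Fin n)) λ xs →
  Unique (x ∷ xs) × (2 ≤ length xs) × Chain G ((x ∷ xs) ∷ʳ x)

IsTree : ∀ {n} → Graph n → Set
IsTree G = Connected G × ¬ HasCycle G

-- Perfect Roman dominating functions; values Fin 3 read as 0,1,2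
IsPRDF : ∀ {n} → Graph n → (Fin n → Fin 3) → Set
IsPRDF {n} G f = ∀ u → f u ≡ zero →
  Σ (Fin n) λ v → (Adj G u v × f v ≡ suc (suc zero)) ×
    (∀ w → Adj G u w → f w ≡ suc (suc zero) → w ≡ v)

weight : ∀ {n} → (Fin n → Fin 3) → ℕ
weight {n} f = sum (map (λ i → toℕ (f i)) (allFin n))

IsGammaFunction : ∀ {n} → Graph n → (Fin n → Fin 3) → Set
IsGammaFunction G f = IsPRDF G f × (∀ g → IsPRDF G g → weight f ≤ weight g)

IsGamma : ∀ {n} → Graph n → ℕ → Set
IsGamma G k = Σ _ λ f → IsGammaFunction G f × weight f ≡ k

delete : ∀ {m} → Graph (suc m) → Fin (suc m) → Graph m
delete G v = record
  { adj    = λ i j → adj G (punchIn v i) (punchIn v j)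
  ; sym    = λ i j → sym G (punchIn v i) (punchIn v j)
  ; irrefl = λ i → irrefl G (punchIn v i) }

PRDStable : ∀ {m} → Graph (suc m) → Set
PRDStable G = ∀ v k → IsGamma G k → IsGamma (delete G v) k

InW : ∀ {n} → Graph n → Fin n → Set
InW G u = ∀ f → IsGammaFunction G f → f u ≡ zero

-- Extension: new vertices 0 = v₁, 1 = v₂, 2 = v₃; old vertex i ↦ 3 + i.
-- Edges: v₁v₂, v₂v₃, v₃u, plus the old edges.
private
  extAdj : ∀ {n} → Graph n → Fin n → Fin (suc (suc (suc n))) → Fin (suc (suc (suc n))) → Bool
  extAdj G u zero (suc zero) = true
  extAdj G u (suc zero) zero = true
  extAdj G u (suc zero) (suc (suc zero)) = true
  extAdj G u (suc (suc zero)) (suc zero) = true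
  extAdj G u (suc (suc zero)) (suc (suc (suc j))) = does (u ≟ j)
  extAdj G u (suc (suc (suc i))) (suc (suc zero)) = does (u ≟ i)
  extAdj G u (suc (suc (suc i))) (suc (suc (suc j))) = adj G i j
  extAdj G u _ _ = false

  extSym : ∀ {n} (G : Graph n) u i j → extAdj G u i j ≡ extAdj G u j i
  extSym G u zero zero = refl
  extSym G u zero (suc zero) = refl
  extSym G u zero (suc (suc zero)) = refl
  extSym G u zero (suc (suc (suc j))) = refl
  extSym G u (suc zero) zero = refl
  extSym G u (suc zero) (suc zero) = refl
  extSym G u (suc zero) (suc (suc zero)) = refl
  extSym G u (suc zero) (suc (suc (suc j))) = refl
  extSym G u (suc (suc zero)) zero = refl
  extSym G u (suc (suc zero)) (suc zero) = refl
  extSym G u (suc (suc zero)) (suc (suc zero)) = refl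
  extSym G u (suc (suc zero)) (suc (suc (suc j))) = refl
  extSym G u (suc (suc (suc i))) zero = refl
  extSym G u (suc (suc (suc i))) (suc zero) = refl
  extSym G u (suc (suc (suc i))) (suc (suc zero)) = refl
  extSym G u (suc (suc (suc i))) (suc (suc (suc j))) = sym G i j

  extIrr : ∀ {n} (G : Graph n) u i → extAdj G u i i ≡ false
  extIrr G u zero = refl
  extIrr G u (suc zero) = refl
  extIrr G u (suc (suc zero)) = refl
  extIrr G u (suc (suc (suc i))) = irrefl G i

extend : ∀ {n} → Graph n → Fin n → Graph (suc (suc (suc n)))
extend G u = record { adj = extAdj G u ; sym = extSym G u ; irrefl = extIrr G u }

module Submission where

-- Tree part (module ExtensionTree): the new vertices lie on no cycle, so every
-- cycle of extend T u is a cycle of T; and every vertex has a walk to u.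
--
-- Module Attached is a restriction/extension calculus for a
-- graph made of k new vertices followed by a copy of H: a PRDF restricts to H
-- when no new vertex of value 2 touches H, and, after raising u from 0 to 1,
-- when only u touches new vertices; conversely PRDFs of H extend.  From it,
-- γ_R^p(extend H u) = γ_R^p(H) + 2 for every H (module Extension, through the
-- general module Shift).  With γ = γ_R^p(T), every vertex-deletion of extend T u
-- has γ_R^p = γ + 2: deleting v₃ or u leaves a disjoint path P₂ resp. P₃
-- (DeleteV₃, DeleteU, the latter with stability of T); deleting v₁ or v₂ uses
-- u ∈ W(T) to bound the weight on T (DeletePendant); deleting another old vertex
-- w gives extend (T - w) u′, handled by Extension and stability of T.

open import Data.Nat using (ℕ; zero; suc; _+_; _≤_; z≤n; s≤s)
open import Data.Nat.Properties using (+-comm; ≤-refl; +-assoc; +-mono-≤; ≤-trans; ≤-reflexive; ≤-pred; ≤-antisym; +-suc; +-monoʳ-≤; +-monoˡ-≤; +-cancelˡ-≤; n≤1+n; _≤?_; ≰⇒>)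
open import Data.Fin using (Fin; zero; suc; toℕ; _↑ʳ_; _≟_; punchIn; punchOut)
open import Data.Fin.Properties using (suc-injective; ↑ʳ-injective; punchInᵢ≢i; punchIn-injective; punchIn-punchOut)
open import Data.Sum using (_⊎_; inj₁; inj₂)
open import Data.Empty using (⊥; ⊥-elim)
open import Relation.Nullary using (¬_; yes; no; does)
open import Relation.Nullary.Decidable using (dec-true; does-⇔)
open import Function.Bundles using (mk⇔)
open import Data.Bool using (true)
open import Data.List using (List; []; _∷_; [_]; _++_; _∷ʳ_; length; map; tabulate)
open import Data.List.Properties using (map-tabulate; ++-identityʳ; ++-assoc; length-++; length-map; map-++)
open import Data.List.Relation.Unary.All as All using (All; []; _∷_)
open import Data.List.Relation.Unary.Any using (here; there)
open import Data.List.Relation.Unary.Unique.Propositional using (Unique; []; _∷_)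
open import Data.List.Relation.Unary.Unique.Propositional.Properties using (++⁺; map⁻)
open import Data.List.Membership.Propositional using (_∈_)
open import Data.List.Membership.Propositional.Properties using (∈-∃++)
open import Data.Unit using (tt)
open import Data.Vec.Functional using () renaming (_∷_ to _∷ᵛ_)
open import Data.Nat.ListAction using (sum)
open import Data.Product using (Σ; _×_; _,_; proj₁; proj₂)
open import Relation.Binary.PropositionalEquality using (_≡_; _≢_; refl; cong; trans; sym; subst; subst₂)
open import Defs hiding (sym)

pattern one = suc zero
pattern two = suc (suc zero)

-- The weight as a sum over 'tabulate'; unlike 'weight' it unfolds definitionally:
-- wt f = toℕ (f zero) + wt (f ∘ suc).
wt : ∀ {n} → (Fin n → Fin 3) → ℕ
wt f = sum (tabulate (λ i → toℕ (f i)))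

weight≡wt : ∀ {n} (f : Fin n → Fin 3) → weight f ≡ wt f
weight≡wt f = cong sum (map-tabulate (λ i → i) (λ i → toℕ (f i)))

raise : Fin 3 → Fin 3
raise zero = one
raise v    = v

raiseAt : ∀ {n} → Fin n → (Fin n → Fin 3) → Fin n → Fin 3
raiseAt zero    f zero    = raise (f zero)
raiseAt zero    f (suc i) = f (suc i)
raiseAt (suc u) f zero    = f zero
raiseAt (suc u) f (suc i) = raiseAt u (λ k → f (suc k)) i

raiseAt-nonzero : ∀ {n} (u : Fin n) f → raiseAt u f u ≢ zero
raiseAt-nonzero zero f with f zero
... | zero = λ ()
... | one  = λ ()
... | two  = λ ()
raiseAt-nonzero (suc u) f = raiseAt-nonzero u (λ k → f (suc k))

raise-two : ∀ v → raise v ≡ two → v ≡ two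
raise-two zero ()
raise-two one  ()
raise-two two  _ = refl

raiseAt-zero : ∀ {n} (u : Fin n) f i → raiseAt u f i ≡ zero → f i ≡ zero × i ≢ u
raiseAt-zero zero    f zero    e = ⊥-elim (raiseAt-nonzero zero f e)
raiseAt-zero zero    f (suc i) e = e , λ ()
raiseAt-zero (suc u) f zero    e = e , λ ()
raiseAt-zero (suc u) f (suc i) e with raiseAt-zero u (λ k → f (suc k)) i e
... | fi≡0 , i≢u = fi≡0 , λ p → i≢u (suc-injective p)

raiseAt-two : ∀ {n} (u : Fin n) f i → raiseAt u f i ≡ two → f i ≡ two
raiseAt-two zero    f zero    e = raise-two (f zero) e
raiseAt-two zero    f (suc i) e = e
raiseAt-two (suc u) f zero    e = e
raiseAt-two (suc u) f (suc i) e = raiseAt-two u (λ k → f (suc k)) i e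

two-raiseAt : ∀ {n} (u : Fin n) f i → f i ≡ two → raiseAt u f i ≡ two
two-raiseAt zero    f zero    e rewrite e = refl
two-raiseAt zero    f (suc i) e = e
two-raiseAt (suc u) f zero    e = e
two-raiseAt (suc u) f (suc i) e = two-raiseAt u (λ k → f (suc k)) i e

raiseAt-weight : ∀ {n} (u : Fin n) f → wt (raiseAt u f) ≤ suc (wt f)
raiseAt-weight zero f = +-monoˡ-≤ (wt (λ k → f (suc k))) (raise-cost (f zero))
  where
  raise-cost : ∀ v → toℕ (raise v) ≤ suc (toℕ v)
  raise-cost zero = s≤s z≤n
  raise-cost one  = n≤1+n 1
  raise-cost two  = n≤1+n 2
raiseAt-weight (suc u) f =
  ≤-trans (+-monoʳ-≤ (toℕ (f zero)) (raiseAt-weight u (λ k → f (suc k))))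
          (≤-reflexive (+-suc (toℕ (f zero)) _))

LowerBound : ∀ {n} → Graph n → ℕ → Set
LowerBound G j = ∀ g → IsPRDF G g → j ≤ wt g

gammaFunction-intro : ∀ {n} (G : Graph n) g → IsPRDF G g → LowerBound G (wt g) → IsGammaFunction G g
gammaFunction-intro G g pg lb =
  pg , λ g′ pg′ → subst₂ _≤_ (sym (weight≡wt g)) (sym (weight≡wt g′)) (lb g′ pg′)

gamma-intro : ∀ {n} (G : Graph n) {k} g → IsPRDF G g → wt g ≡ k → LowerBound G k → IsGamma G k
gamma-intro G g pg refl lb = g , gammaFunction-intro G g pg lb , weight≡wt g

gamma-lower : ∀ {n} (G : Graph n) {k} → IsGamma G k → LowerBound G k
gamma-lower G (f , (_ , minimal) , wf) g pg = subst₂ _≤_ wf (weight≡wt g) (minimal g pg)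

-- For u ∈ W(G), a PRDF that does not vanish at u is heavier than γ_R^p(G):
-- otherwise it would be a γ_R^p-function with a nonzero value at u.
W-excess : ∀ {n} (G : Graph n) {k u} → IsGamma G k → InW G u →
  ∀ h → IsPRDF G h → h u ≢ zero → suc k ≤ wt h
W-excess G {k} γ u∈W h ph hu≢0 with wt h ≤? k
... | yes light = ⊥-elim (hu≢0 (u∈W h (gammaFunction-intro G h ph
                    (λ g pg → ≤-trans light (gamma-lower G γ g pg)))))
... | no heavy = ≰⇒> heavy

module Shift {n N} {H : Graph n} {G : Graph N} (c : ℕ)
  (lift : ∀ h → IsPRDF H h → Σ _ λ g → IsPRDF G g × wt g ≡ c + wt h)
  (drop : ∀ g → IsPRDF G g → Σ _ λ h → IsPRDF H h × c + wt h ≤ wt g) where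

  lower-shift : ∀ {j} → LowerBound H j → LowerBound G (c + j)
  lower-shift lb g pg with drop g pg
  ... | h , ph , saving = ≤-trans (+-monoʳ-≤ c (lb h ph)) saving

  gamma-shift : ∀ {j} → IsGamma H j → IsGamma G (c + j)
  gamma-shift γ@(h , (ph , _) , refl) with lift h ph
  ... | g , pg , cost = gamma-intro G g pg (trans cost (cong (c +_) (sym (weight≡wt h))))
                          (lower-shift (gamma-lower H γ))

  gamma-unshift : ∀ {k} → IsGamma G k → Σ ℕ λ j → IsGamma H j × k ≡ c + j
  gamma-unshift {k} γ@(g , (pg , _) , wg) with drop g pg
  ... | h , ph , saving = wt h , gamma-intro H h ph refl minimal , ≤-antisym upper (≤-trans saving k≥wt)
    where
    k≥wt : wt g ≤ k
    k≥wt = ≤-reflexive (trans (sym (weight≡wt g)) wg)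
    lifted : ∀ h′ → IsPRDF H h′ → k ≤ c + wt h′
    lifted h′ ph′ with lift h′ ph′
    ... | g′ , pg′ , cost = ≤-trans (gamma-lower G γ g′ pg′) (≤-reflexive cost)
    minimal : LowerBound H (wt h)
    minimal h′ ph′ = +-cancelˡ-≤ c _ _ (≤-trans saving (≤-trans k≥wt (lifted h′ ph′)))
    upper : k ≤ c + wt h
    upper = lifted h ph

-- v has exactly one neighbour of value 2 under f; a PRDF asks this of every
-- vertex of value 0, i.e. IsPRDF G f = ∀ v → f v ≡ 0 → PerfectlyDominated G f v.
PerfectlyDominated : ∀ {n} → Graph n → (Fin n → Fin 3) → Fin n → Set
PerfectlyDominated {n} G f v =
  Σ (Fin n) λ w → (Adj G v w × f w ≡ two) × (∀ w′ → Adj G v w′ → f w′ ≡ two → w′ ≡ w)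

dominator-in : ∀ {n} (G : Graph n) g v (P : Fin n → Set) → IsPRDF G g → g v ≡ zero →
  (∀ w → Adj G v w → P w) → Σ (Fin n) λ w → P w × g w ≡ two
dominator-in G g v P pg gv≡0 nbrs with pg v gv≡0
... | w , (aw , gw) , _ = w , nbrs w aw , gw

leaf-dominated : ∀ {n} (G : Graph n) g v y → IsPRDF G g → (∀ w → Adj G v w → w ≡ y) →
  g v ≡ zero → g y ≡ two
leaf-dominated G g v y pg leaf gv≡0 with dominator-in G g v (_≡ y) pg gv≡0 leaf
... | _ , refl , gy≡2 = gy≡2

between-dominated : ∀ {n} (G : Graph n) g v y z → IsPRDF G g → (∀ w → Adj G v w → w ≡ y ⊎ w ≡ z) →
  g v ≡ zero → g y ≡ two ⊎ g z ≡ two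
between-dominated G g v y z pg nbrs gv≡0 with dominator-in G g v _ pg gv≡0 nbrs
... | _ , inj₁ refl , gy≡2 = inj₁ gy≡2
... | _ , inj₂ refl , gz≡2 = inj₂ gz≡2

-- G consists of k new vertices followed by a copy of H: the old vertex i of H
-- is k ↑ʳ i, and two old vertices are adjacent in G iff they are in H.
module Attached (k : ℕ) {n} (H : Graph n) (G : Graph (k + n))
  (adj-old : ∀ i j → adj G (k ↑ʳ i) (k ↑ʳ j) ≡ adj H i j) where

  old : Fin n → Fin (k + n)
  old i = k ↑ʳ i

  Old : Fin (k + n) → Set
  Old x = Σ (Fin n) λ j → x ≡ old j

  TwosNearOldAreOld : (Fin (k + n) → Fin 3) → Set
  TwosNearOldAreOld g = ∀ i x → Adj G (old i) x → g x ≡ two → Old x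

  Detached : Set
  Detached = ∀ i x → Adj G (old i) x → Old x

  PendantEdge : Fin n → Fin (k + n) → Set
  PendantEdge u y = ∀ i x → Adj G (old i) x → Old x ⊎ (i ≡ u × x ≡ y)

  detached-twos : Detached → ∀ g → TwosNearOldAreOld g
  detached-twos detached g i x ax _ = detached i x ax

  pendant-twos : ∀ {u y} → PendantEdge u y → ∀ g → g y ≢ two → TwosNearOldAreOld g
  pendant-twos pendant g gy≢2 i x ax gx with pendant i x ax
  ... | inj₁ x-old        = x-old
  ... | inj₂ (_ , refl)  = ⊥-elim (gy≢2 gx)

  pendant-away : ∀ {u y} → PendantEdge u y → ∀ i x → i ≢ u → Adj G (old i) x → Old x
  pendant-away pendant i x i≢u ax with pendant i x ax
  ... | inj₁ x-old       = x-old
  ... | inj₂ (i≡u , _)  = ⊥-elim (i≢u i≡u)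

  dominated-restrict : ∀ g h → (∀ j → h j ≡ two → g (old j) ≡ two) → (∀ j → g (old j) ≡ two → h j ≡ two) →
    ∀ i → (∀ x → Adj G (old i) x → g x ≡ two → Old x) →
    PerfectlyDominated G g (old i) → PerfectlyDominated H h i
  dominated-restrict g h to from i near (x , (ax , gx) , unique) with near x ax gx
  ... | j , refl = j , (trans (sym (adj-old i j)) ax , from j gx) ,
    λ w aw hw → ↑ʳ-injective k w j (unique (old w) (trans (adj-old i w) aw) (to w hw))

  restrict : ∀ g → IsPRDF G g → TwosNearOldAreOld g → IsPRDF H (λ i → g (old i))
  restrict g pg near i gi≡0 =
    dominated-restrict g (λ j → g (old j)) (λ _ e → e) (λ _ e → e) i (near i) (pg (old i) gi≡0)

  restrict-raised : ∀ u g → IsPRDF G g → (∀ i x → i ≢ u → Adj G (old i) x → Old x) →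
    IsPRDF H (raiseAt u (λ i → g (old i)))
  restrict-raised u g pg onlyU i hi≡0 with raiseAt-zero u (λ j → g (old j)) i hi≡0
  ... | gi≡0 , i≢u = dominated-restrict g (raiseAt u (λ j → g (old j)))
          (λ j → raiseAt-two u _ j) (λ j → two-raiseAt u _ j)
          i (λ x ax _ → onlyU i x i≢u ax) (pg (old i) gi≡0)

  dominated-extend : ∀ g → IsPRDF H (λ i → g (old i)) → TwosNearOldAreOld g →
    ∀ i → g (old i) ≡ zero → PerfectlyDominated G g (old i)
  dominated-extend g ph near i gi≡0 with ph i gi≡0
  ... | x , (ax , gx) , unique = old x , (trans (adj-old i x) ax , gx) , only-x
    where
    only-x : ∀ w → Adj G (old i) w → g w ≡ two → w ≡ old x
    only-x w aw gw with near i w aw gw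
    ... | j , refl = cong old (unique j (trans (sym (adj-old i j)) aw) gw)

  module WeightOnOld {u y j} (pendant : PendantEdge u y) (γ : IsGamma H j) (u∈W : InW H u)
    (g : Fin (k + n) → Fin 3) (pg : IsPRDF G g) where

    weight-on-old : j ≤ wt (λ i → g (old i))
    weight-on-old with g y ≟ two
    -- y has value 2: raising u repairs the restriction, and the raised
    -- function, nonzero at u, weighs at least j + 1.
    ... | yes _ = ≤-pred (≤-trans (W-excess H γ u∈W _ (restrict-raised u g pg (pendant-away pendant))
                                      (raiseAt-nonzero u _))
                                  (raiseAt-weight u _))
    ... | no gy≢2 = gamma-lower H γ _ (restrict g pg (pendant-twos pendant g gy≢2))

    weight-on-old-strict : g (old u) ≢ zero → g y ≢ two → suc j ≤ wt (λ i → g (old i))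
    weight-on-old-strict gu≢0 gy≢2 = W-excess H γ u∈W _ (restrict g pg (pendant-twos pendant g gy≢2)) gu≢0

leaf-weight : ∀ (a b : Fin 3) → (a ≡ zero → b ≡ two) → 1 ≤ toℕ a + toℕ b
leaf-weight zero b leaf rewrite leaf refl = s≤s z≤n
leaf-weight one  _ _ = s≤s z≤n
leaf-weight two  _ _ = s≤s z≤n

path-weight : ∀ (a b c : Fin 3) → (a ≡ zero → b ≡ two) → (b ≡ zero → a ≡ two ⊎ c ≡ two) →
  2 ≤ toℕ a + (toℕ b + toℕ c)
path-weight zero zero _ leaf _ with leaf refl
... | ()
path-weight zero one _ leaf _ with leaf refl
... | ()
path-weight zero two _ _ _ = s≤s (s≤s z≤n)
path-weight one zero c _ mid with mid refl
... | inj₂ refl = s≤s (s≤s z≤n)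
path-weight one one  _ _ _ = s≤s (s≤s z≤n)
path-weight one two  _ _ _ = s≤s (s≤s z≤n)
path-weight two _    _ _ _ = s≤s (s≤s z≤n)

path-weight-v₃ : ∀ (a b c : Fin 3) → (a ≡ zero → b ≡ two) → c ≡ two → 3 ≤ toℕ a + (toℕ b + toℕ c)
path-weight-v₃ a b .two leaf refl =
  ≤-trans (+-monoˡ-≤ 2 (leaf-weight a b leaf)) (≤-reflexive (+-assoc (toℕ a) (toℕ b) 2))

pair-weight : ∀ (a b : Fin 3) → (a ≡ zero → b ≡ two) → (b ≡ zero → a ≡ two) → 2 ≤ toℕ a + toℕ b
pair-weight zero b first _ rewrite first refl = s≤s (s≤s z≤n)
pair-weight one zero _ second with second refl
... | ()
pair-weight one one _ _ = s≤s (s≤s z≤n)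
pair-weight one two _ _ = s≤s (s≤s z≤n)
pair-weight two b _ _ = s≤s (s≤s z≤n)

two⇒≢zero : ∀ {a : Fin 3} → a ≡ two → a ≢ zero
two⇒≢zero refl ()

zero⇒≢two : ∀ {a : Fin 3} → a ≡ zero → a ≢ two
zero⇒≢two refl ()


weight-split₂ : ∀ {p q} a b w → p ≤ a + b → q ≤ w → p + q ≤ a + (b + w)
weight-split₂ a b w new old = ≤-trans (+-mono-≤ new old) (≤-reflexive (+-assoc a b w))

weight-split₃ : ∀ {p q} a b c w → p ≤ a + (b + c) → q ≤ w → p + q ≤ a + (b + (c + w))
weight-split₃ {p} {q} a b c w new old =
  subst (p + q ≤_) (cong (a +_) (+-assoc b c w)) (weight-split₂ a (b + c) w new old)

attached-at-u : ∀ {n} (u j : Fin n) → does (u ≟ j) ≡ true → u ≡ j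
attached-at-u u j with u ≟ j
... | yes u≡j = λ _ → u≡j
... | no _    = λ ()

module Extension {n} (H : Graph n) (u : Fin n) where
  private
    E = extend H u
  open Attached 3 H E (λ _ _ → refl)

  v₁-neighbour : ∀ w → Adj E zero w → w ≡ one
  v₁-neighbour one _ = refl
  v₁-neighbour zero ()
  v₁-neighbour two ()
  v₁-neighbour (suc (suc (suc _))) ()

  v₂-neighbours : ∀ w → Adj E one w → w ≡ zero ⊎ w ≡ two
  v₂-neighbours zero _ = inj₁ refl
  v₂-neighbours two  _ = inj₂ refl
  v₂-neighbours one ()
  v₂-neighbours (suc (suc (suc _))) ()

  v₃-neighbours : ∀ w → Adj E two w → w ≡ one ⊎ w ≡ old u
  v₃-neighbours one _ = inj₁ refl
  v₃-neighbours (suc (suc (suc j))) a = inj₂ (cong old (sym (attached-at-u u j a)))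
  v₃-neighbours zero ()
  v₃-neighbours two ()

  pendant : PendantEdge u two
  pendant i zero ()
  pendant i one ()
  pendant i two a = inj₂ (sym (attached-at-u u i a) , refl)
  pendant i (suc (suc (suc j))) _ = inj₁ (j , refl)

  -- A PRDF of H extends at cost 2: by 2 on v₁ if u already has value 2
  -- (then u dominates v₃), and by 2 on v₂ otherwise.
  lift : ∀ h → IsPRDF H h → Σ _ λ g → IsPRDF E g × wt g ≡ 2 + wt h
  lift h ph with h u ≟ two
  ... | yes hu≡2 = g , pg , refl
    where
    g = two ∷ᵛ zero ∷ᵛ zero ∷ᵛ h
    pg : IsPRDF E g
    pg one _ = zero , (refl , refl) , only-v₁
      where
      only-v₁ : ∀ w → Adj E one w → g w ≡ two → w ≡ zero
      only-v₁ w aw gw with v₂-neighbours w aw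
      ... | inj₁ w≡v₁ = w≡v₁
      ... | inj₂ refl = ⊥-elim (zero⇒≢two refl gw)
    pg two _ = old u , (dec-true (u ≟ u) refl , hu≡2) , only-u
      where
      only-u : ∀ w → Adj E two w → g w ≡ two → w ≡ old u
      only-u w aw gw with v₃-neighbours w aw
      ... | inj₂ w≡u  = w≡u
      ... | inj₁ refl = ⊥-elim (zero⇒≢two refl gw)
    pg (suc (suc (suc i))) = dominated-extend g ph (pendant-twos pendant g (λ ())) i
  ... | no hu≢2 = g , pg , refl
    where
    g = zero ∷ᵛ two ∷ᵛ zero ∷ᵛ h
    pg : IsPRDF E g
    pg zero _ = one , (refl , refl) , λ w aw _ → v₁-neighbour w aw
    pg two _ = one , (refl , refl) , only-v₂
      where
      only-v₂ : ∀ w → Adj E two w → g w ≡ two → w ≡ one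
      only-v₂ w aw gw with v₃-neighbours w aw
      ... | inj₁ w≡v₂ = w≡v₂
      ... | inj₂ refl = ⊥-elim (hu≢2 gw)
    pg (suc (suc (suc i))) = dominated-extend g ph (pendant-twos pendant g (λ ())) i

  -- A PRDF of E restricts to H saving at least 2: the path v₁v₂v₃ carries
  -- weight ≥ 2; if v₃ has value 2 it carries ≥ 3, and raising u to 1
  -- repairs the restriction at the cost of 1.
  drop : ∀ g → IsPRDF E g → Σ _ λ h → IsPRDF H h × 2 + wt h ≤ wt g
  drop g pg with g two ≟ two
  ... | no g₃≢2 = _ , restrict g pg (pendant-twos pendant g g₃≢2) ,
          weight-split₃ (toℕ (g zero)) (toℕ (g one)) (toℕ (g two)) _
            (path-weight (g zero) (g one) (g two) (leaf-dominated E g zero one pg v₁-neighbour)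
              (between-dominated E g one zero two pg v₂-neighbours)) ≤-refl
  ... | yes g₃≡2 = _ , restrict-raised u g pg (pendant-away pendant) ,
          ≤-trans (+-monoʳ-≤ 2 (raiseAt-weight u _))
            (weight-split₃ (toℕ (g zero)) (toℕ (g one)) (toℕ (g two)) _
              (path-weight-v₃ (g zero) (g one) (g two) (leaf-dominated E g zero one pg v₁-neighbour) g₃≡2) ≤-refl)

  open Shift {H = H} {G = E} 2 lift drop public using (gamma-shift; gamma-unshift)

-- Deleting v₃ from extend T u leaves T plus a disjoint edge v₁v₂, so γ_R^p grows by 2.
-- Vertices of the deleted graph: v₁ = 0, v₂ = 1, old vertices 2 + i.
module DeleteV₃ {n} (T : Graph n) (u : Fin n) where
  private
    D = delete (extend T u) two
  open Attached 2 T D (λ _ _ → refl)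

  detached : Detached
  detached i zero ()
  detached i one ()
  detached i (suc (suc k)) _ = k , refl

  v₁-neighbour : ∀ w → Adj D zero w → w ≡ one
  v₁-neighbour one _ = refl
  v₁-neighbour zero ()
  v₁-neighbour (suc (suc _)) ()

  v₂-neighbour : ∀ w → Adj D one w → w ≡ zero
  v₂-neighbour zero _ = refl
  v₂-neighbour one ()
  v₂-neighbour (suc (suc _)) ()

  -- Value 2 on v₂ dominates v₁; conversely the edge v₁v₂ always carries weight ≥ 2.
  lift : ∀ h → IsPRDF T h → Σ _ λ g → IsPRDF D g × wt g ≡ 2 + wt h
  lift h ph = g , pg , refl
    where
    g = zero ∷ᵛ two ∷ᵛ h
    pg : IsPRDF D g
    pg zero _ = one , (refl , refl) , λ w aw _ → v₁-neighbour w aw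
    pg (suc (suc i)) = dominated-extend g ph (detached-twos detached g) i

  drop : ∀ g → IsPRDF D g → Σ _ λ h → IsPRDF T h × 2 + wt h ≤ wt g
  drop g pg = _ , restrict g pg (detached-twos detached g) ,
    weight-split₂ (toℕ (g zero)) (toℕ (g one)) _
      (pair-weight (g zero) (g one) (leaf-dominated D g zero one pg v₁-neighbour)
                                    (leaf-dominated D g one zero pg v₂-neighbour)) ≤-refl

  open Shift {H = T} {G = D} 2 lift drop public using (gamma-shift)

-- Deleting the old vertex u from extend T u leaves T - u plus a disjoint path
-- v₁v₂v₃, so γ_R^p(T - u) grows by 2.
module DeleteU {m} (T : Graph (suc m)) (u : Fin (suc m)) where
  private
    D = delete (extend T u) (suc (suc (suc u)))
  open Attached 3 (delete T u) D (λ _ _ → refl)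

  u-not-old : ∀ i → does (u ≟ punchIn u i) ≡ true → ⊥
  u-not-old i a = punchInᵢ≢i u i (sym (attached-at-u u (punchIn u i) a))

  detached : Detached
  detached i zero ()
  detached i one ()
  detached i two a = ⊥-elim (u-not-old i a)
  detached i (suc (suc (suc k))) _ = k , refl

  v₁-neighbour : ∀ w → Adj D zero w → w ≡ one
  v₁-neighbour one _ = refl
  v₁-neighbour zero ()
  v₁-neighbour two ()
  v₁-neighbour (suc (suc (suc _))) ()

  v₂-neighbours : ∀ w → Adj D one w → w ≡ zero ⊎ w ≡ two
  v₂-neighbours zero _ = inj₁ refl
  v₂-neighbours two  _ = inj₂ refl
  v₂-neighbours one ()
  v₂-neighbours (suc (suc (suc _))) ()

  v₃-neighbour : ∀ w → Adj D two w → w ≡ one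
  v₃-neighbour one _ = refl
  v₃-neighbour (suc (suc (suc k))) a = ⊥-elim (u-not-old k a)
  v₃-neighbour zero ()
  v₃-neighbour two ()

  -- Value 2 on v₂ dominates v₁ and v₃; conversely the path carries weight ≥ 2.
  lift : ∀ h → IsPRDF (delete T u) h → Σ _ λ g → IsPRDF D g × wt g ≡ 2 + wt h
  lift h ph = g , pg , refl
    where
    g = zero ∷ᵛ two ∷ᵛ zero ∷ᵛ h
    pg : IsPRDF D g
    pg zero _ = one , (refl , refl) , λ w aw _ → v₁-neighbour w aw
    pg two  _ = one , (refl , refl) , λ w aw _ → v₃-neighbour w aw
    pg (suc (suc (suc i))) = dominated-extend g ph (detached-twos detached g) i

  drop : ∀ g → IsPRDF D g → Σ _ λ h → IsPRDF (delete T u) h × 2 + wt h ≤ wt g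
  drop g pg = _ , restrict g pg (detached-twos detached g) ,
    weight-split₃ (toℕ (g zero)) (toℕ (g one)) (toℕ (g two)) _
      (path-weight (g zero) (g one) (g two) (leaf-dominated D g zero one pg v₁-neighbour)
        (between-dominated D g one zero two pg v₂-neighbours))
      ≤-refl

  open Shift {H = delete T u} {G = D} 2 lift drop public using (gamma-shift)

-- Deleting v₁ or v₂ from extend T u keeps γ_R^p at γ_R^p(T) + 2 when u ∈ W(T).
-- In both deleted graphs vertex 1 is v₃, the only new neighbour of u, and old
-- vertices are 2 + i.
module DeletePendant {m} (T : Graph (suc m)) (u : Fin (suc m)) (u∈W : InW T u)
  {j} (γ : IsGamma T j) where
  private
    h₀ : Fin (suc m) → Fin 3
    h₀ = proj₁ γ
    h₀-prdf : IsPRDF T h₀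
    h₀-prdf = proj₁ (proj₁ (proj₂ γ))
    h₀-weight : wt h₀ ≡ j
    h₀-weight = trans (sym (weight≡wt h₀)) (proj₂ (proj₂ γ))
    h₀u≡0 : h₀ u ≡ zero
    h₀u≡0 = u∈W h₀ (proj₁ (proj₂ γ))

  -- Deleting v₁: the path v₂v₃ hangs from u; v₂ = 0, v₃ = 1.
  module V₁ where
    private
      D = delete (extend T u) zero
    open Attached 2 T D (λ _ _ → refl)
    open WeightOnOld

    pendant : PendantEdge u one
    pendant i zero ()
    pendant i one a = inj₂ (sym (attached-at-u u i a) , refl)
    pendant i (suc (suc k)) _ = inj₁ (k , refl)

    v₂-neighbour : ∀ w → Adj D zero w → w ≡ one
    v₂-neighbour one _ = refl
    v₂-neighbour zero ()
    v₂-neighbour (suc (suc _)) ()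

    v₃-neighbours : ∀ w → Adj D one w → w ≡ zero ⊎ w ≡ old u
    v₃-neighbours zero _ = inj₁ refl
    v₃-neighbours (suc (suc k)) a = inj₂ (cong old (sym (attached-at-u u k a)))
    v₃-neighbours one ()

    -- 2 on v₂ dominates v₃, since u has value 0 under every γ_R^p-function of T.
    witness : IsPRDF D (two ∷ᵛ zero ∷ᵛ h₀)
    witness one _ = zero , (refl , refl) , only-v₂
      where
      only-v₂ : ∀ w → Adj D one w → (two ∷ᵛ zero ∷ᵛ h₀) w ≡ two → w ≡ zero
      only-v₂ w aw gw with v₃-neighbours w aw
      ... | inj₁ w≡v₂ = w≡v₂
      ... | inj₂ refl = ⊥-elim (zero⇒≢two h₀u≡0 gw)
    witness (suc (suc i)) =
      dominated-extend (two ∷ᵛ zero ∷ᵛ h₀) h₀-prdf (pendant-twos pendant _ (λ ())) i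

    -- If v₃ ≠ 0, or v₃ = 0 is dominated by v₂, then v₂v₃ carries weight ≥ 2 and
    -- the old vertices ≥ γ; if v₃ = 0 is dominated by u, the old vertices carry ≥ γ + 1.
    lower : LowerBound D (2 + j)
    lower g pg with g one ≟ zero
    ... | no g₃≢0 = weight-split₂ (toℕ (g zero)) (toℕ (g one)) _
          (pair-weight (g zero) (g one) (leaf-dominated D g zero one pg v₂-neighbour)
                                        (λ g₃≡0 → ⊥-elim (g₃≢0 g₃≡0)))
          (weight-on-old pendant γ u∈W g pg)
    ... | yes g₃≡0 with between-dominated D g one zero (old u) pg v₃-neighbours g₃≡0
    ...   | inj₁ g₂≡2 = weight-split₂ (toℕ (g zero)) (toℕ (g one)) _
            (pair-weight (g zero) (g one) (leaf-dominated D g zero one pg v₂-neighbour) (λ _ → g₂≡2))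
            (weight-on-old pendant γ u∈W g pg)
    ...   | inj₂ gu≡2 = weight-split₂ (toℕ (g zero)) (toℕ (g one)) _
            (leaf-weight (g zero) (g one) (leaf-dominated D g zero one pg v₂-neighbour))
            (weight-on-old-strict pendant γ u∈W g pg (two⇒≢zero gu≡2) (zero⇒≢two g₃≡0))

    delete-v₁ : IsGamma D (2 + j)
    delete-v₁ = gamma-intro D _ witness (cong (2 +_) h₀-weight) lower

  -- Deleting v₂: v₁ = 0 is isolated and v₃ = 1 is a leaf at u.
  module V₂ where
    private
      D = delete (extend T u) one
    open Attached 2 T D (λ _ _ → refl)
    open WeightOnOld

    pendant : PendantEdge u one
    pendant i zero ()
    pendant i one a = inj₂ (sym (attached-at-u u i a) , refl)
    pendant i (suc (suc k)) _ = inj₁ (k , refl)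

    v₃-neighbour : ∀ w → Adj D one w → w ≡ old u
    v₃-neighbour (suc (suc k)) a = cong old (sym (attached-at-u u k a))
    v₃-neighbour zero ()
    v₃-neighbour one ()

    v₁-isolated : ∀ g → IsPRDF D g → g zero ≢ zero
    v₁-isolated g pg g₁≡0 with pg zero g₁≡0
    ... | zero , (() , _) , _
    ... | one , (() , _) , _
    ... | suc (suc _) , (() , _) , _

    -- Value 1 on v₁ and v₃, so no new vertex needs to be dominated.
    witness : IsPRDF D (one ∷ᵛ one ∷ᵛ h₀)
    witness (suc (suc i)) =
      dominated-extend (one ∷ᵛ one ∷ᵛ h₀) h₀-prdf (pendant-twos pendant _ (λ ())) i

    -- The isolated v₁ has value ≥ 1; if v₃ ≠ 0 the new vertices carry ≥ 2, and if
    -- v₃ = 0 then u has value 2 and the old vertices carry ≥ γ + 1.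
    lower : LowerBound D (2 + j)
    lower g pg with g one ≟ zero
    ... | no g₃≢0 = weight-split₂ (toℕ (g zero)) (toℕ (g one)) _
          (pair-weight (g zero) (g one) (λ g₁≡0 → ⊥-elim (v₁-isolated g pg g₁≡0))
                                        (λ g₃≡0 → ⊥-elim (g₃≢0 g₃≡0)))
          (weight-on-old pendant γ u∈W g pg)
    ... | yes g₃≡0 = weight-split₂ (toℕ (g zero)) (toℕ (g one)) _
          (leaf-weight (g zero) (g one) (λ g₁≡0 → ⊥-elim (v₁-isolated g pg g₁≡0)))
          (weight-on-old-strict pendant γ u∈W g pg
            (two⇒≢zero (leaf-dominated D g one (old u) pg v₃-neighbour g₃≡0)) (zero⇒≢two g₃≡0))

    delete-v₂ : IsGamma D (2 + j)
    delete-v₂ = gamma-intro D _ witness (cong (2 +_) h₀-weight) lower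

same-adjacency-prdf : ∀ {n} (G G′ : Graph n) → (∀ x y → adj G x y ≡ adj G′ x y) →
  ∀ f → IsPRDF G f → IsPRDF G′ f
same-adjacency-prdf G G′ same f pf v fv≡0 with pf v fv≡0
... | w , (aw , fw) , unique =
  w , (trans (sym (same v w)) aw , fw) , λ w′ aw′ fw′ → unique w′ (trans (same v w′) aw′) fw′

same-adjacency-gamma : ∀ {n} (G G′ : Graph n) → (∀ x y → adj G x y ≡ adj G′ x y) →
  ∀ {k} → IsGamma G k → IsGamma G′ k
same-adjacency-gamma G G′ same (f , (pf , minimal) , wf) =
  f , (same-adjacency-prdf G G′ same f pf ,
       λ g pg → minimal g (same-adjacency-prdf G′ G (λ x y → sym (same x y)) g pg)) , wf

punchIn-≟ : ∀ {m} (w : Fin (suc m)) a b → does (punchIn w a ≟ punchIn w b) ≡ does (a ≟ b)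
punchIn-≟ w a b = does-⇔ (mk⇔ (punchIn-injective w a b) (cong (punchIn w))) (punchIn w a ≟ punchIn w b) (a ≟ b)

delete-extend : ∀ {m} (T : Graph (suc m)) (w : Fin (suc m)) (u′ : Fin m) → ∀ x y →
  adj (delete (extend T (punchIn w u′)) (suc (suc (suc w)))) x y ≡ adj (extend (delete T w) u′) x y
delete-extend T w u′ two (suc (suc (suc y))) = punchIn-≟ w u′ y
delete-extend T w u′ (suc (suc (suc x))) two = punchIn-≟ w u′ x
delete-extend T w u′ (suc (suc (suc x))) (suc (suc (suc y))) = refl
delete-extend T w u′ zero zero = refl
delete-extend T w u′ zero one = refl
delete-extend T w u′ zero two = refl
delete-extend T w u′ zero (suc (suc (suc y))) = refl
delete-extend T w u′ one zero = refl
delete-extend T w u′ one one = refl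
delete-extend T w u′ one two = refl
delete-extend T w u′ one (suc (suc (suc y))) = refl
delete-extend T w u′ two zero = refl
delete-extend T w u′ two one = refl
delete-extend T w u′ two two = refl
delete-extend T w u′ (suc (suc (suc x))) zero = refl
delete-extend T w u′ (suc (suc (suc x))) one = refl

extend-stable : ∀ {m} (T : Graph (suc m)) (u : Fin (suc m)) → PRDStable T → InW T u →
  PRDStable (extend T u)
extend-stable T u stable u∈W v k γk with Extension.gamma-unshift T u γk
... | j , γ , refl = deletion v
  where
  deletion : ∀ v → IsGamma (delete (extend T u) v) (2 + j)
  deletion zero = DeletePendant.V₁.delete-v₁ T u u∈W γ
  deletion one  = DeletePendant.V₂.delete-v₂ T u u∈W γ
  deletion two  = DeleteV₃.gamma-shift T u γ
  deletion (suc (suc (suc w))) with w ≟ u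
  ... | yes refl = DeleteU.gamma-shift T w (stable w j γ)
  ... | no w≢u = subst (λ x → IsGamma (delete (extend T x) (suc (suc (suc w)))) (2 + j))
                   (punchIn-punchOut w≢u) (delete-old (punchOut w≢u))
    where
    delete-old : ∀ u′ → IsGamma (delete (extend T (punchIn w u′)) (suc (suc (suc w)))) (2 + j)
    delete-old u′ =
      same-adjacency-gamma (extend (delete T w) u′) (delete (extend T (punchIn w u′)) (suc (suc (suc w))))
        (λ x y → sym (delete-extend T w u′ x y))
        (Extension.gamma-shift (delete T w) u′ (stable w j γ))

adj-sym : ∀ {n} (G : Graph n) {a b} → Adj G a b → Adj G b a
adj-sym G {a} {b} p = trans (Graph.sym G b a) p

walk-++ : ∀ {n} {G : Graph n} {a b c} → Walk G a b → Walk G b c → Walk G a c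
walk-++ here       w′ = w′
walk-++ (step p w) w′ = step p (walk-++ w w′)

walk-reverse : ∀ {n} {G : Graph n} {a b} → Walk G a b → Walk G b a
walk-reverse here               = here
walk-reverse {G = G} (step p w) = walk-++ (walk-reverse w) (step (adj-sym G p) here)

connected-via : ∀ {n} (G : Graph n) r → (∀ x → Walk G x r) → Connected G
connected-via G r to-r a b = walk-++ (to-r a) (walk-reverse (to-r b))

-- The list x ∷ xs describes a cycle through x (so HasCycle G is Σ x xs. Cycle G (x ∷ xs)).
Cycle : ∀ {n} → Graph n → List (Fin n) → Set
Cycle G []       = ⊥
Cycle G (x ∷ xs) = Unique (x ∷ xs) × (2 ≤ length xs) × Chain G ((x ∷ xs) ∷ʳ x)

OffCycles : ∀ {n} → Graph n → Fin n → Set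
OffCycles G v = ∀ c → Cycle G c → v ∈ c → ⊥

module Cycles {n} (G : Graph n) where

  chain-∷ʳ : ∀ a l x y → Chain G ((a ∷ l) ∷ʳ x) → Adj G x y → Chain G (((a ∷ l) ∷ʳ x) ∷ʳ y)
  chain-∷ʳ a []      x y (ax , _) xy = ax , xy , tt
  chain-∷ʳ a (b ∷ l) x y (ab , c) xy = ab , chain-∷ʳ b l x y c xy

  unique-∷ʳ : ∀ {a : Fin n} l → Unique (a ∷ l) → Unique (l ∷ʳ a)
  unique-∷ʳ l (a∉l ∷ l-unique) = ++⁺ l-unique ([] ∷ []) λ { (v∈l , here refl) → All.lookup a∉l v∈l refl }

  rotate : ∀ a r → Cycle G (a ∷ r) → Cycle G (r ∷ʳ a)
  rotate a []       (_ , () , _)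
  rotate a (y ∷ ys) (unique , long , (ay , chain)) =
    unique-∷ʳ (y ∷ ys) unique ,
    subst (2 ≤_) (sym (trans (length-++ ys) (+-comm (length ys) 1))) long , chain-∷ʳ y ys a y chain ay

  rotate-to : ∀ pre z post → Cycle G (pre ++ z ∷ post) → Cycle G (z ∷ post ++ pre)
  rotate-to [] z post c = subst (Cycle G) (cong (z ∷_) (sym (++-identityʳ post))) c
  rotate-to (a ∷ pre) z post c =
    subst (Cycle G) (cong (z ∷_) (++-assoc post [ a ] pre))
      (rotate-to pre z (post ∷ʳ a) (subst (Cycle G) (++-assoc pre (z ∷ post) [ a ]) (rotate a _ c)))

  cycle-through : ∀ {v} c → Cycle G c → v ∈ c → Σ (List (Fin n)) λ xs → Cycle G (v ∷ xs)
  cycle-through {v} c cycle v∈c with ∈-∃++ v∈c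
  ... | pre , post , refl = post ++ pre , rotate-to pre v post cycle

  last-edge : ∀ y l x → Chain G ((y ∷ l) ∷ʳ x) → Σ (Fin n) λ z → z ∈ (y ∷ l) × Adj G z x
  last-edge y []       x (yx , _) = y , here refl , yx
  last-edge y (y′ ∷ l) x (_ , c) with last-edge y′ l x c
  ... | z , z∈l , zx = z , there z∈l , zx

  cycle-neighbours : ∀ x xs → Cycle G (x ∷ xs) → Σ (Fin n) λ y → Σ (Fin n) λ z →
    Adj G x y × Adj G x z × y ≢ z × y ∈ xs × z ∈ xs
  cycle-neighbours x []           (_ , () , _)
  cycle-neighbours x (y ∷ [])     (_ , s≤s () , _)
  cycle-neighbours x (y ∷ y′ ∷ ys) (_ ∷ (y∉ ∷ _) , _ , (xy , (_ , c))) with last-edge y′ ys x c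
  ... | z , z∈ , zx = y , z , xy , adj-sym G zx , All.lookup y∉ z∈ , here refl , there z∈

  off-cycles : ∀ v p → (∀ y → Adj G v y → y ≡ p ⊎ OffCycles G y) → OffCycles G v
  off-cycles v p nbrs c cycle v∈c with cycle-through c cycle v∈c
  ... | xs , cycle′ with cycle-neighbours v xs cycle′
  ...   | y , z , vy , vz , y≢z , y∈ , z∈ with nbrs y vy | nbrs z vz
  ...     | inj₂ y-off | _          = y-off (v ∷ xs) cycle′ (there y∈)
  ...     | _          | inj₂ z-off = z-off (v ∷ xs) cycle′ (there z∈)
  ...     | inj₁ y≡p   | inj₁ z≡p   = y≢z (trans y≡p (sym z≡p))

-- extend T u is a tree when T is: the new vertices lie on no cycle (v₁ is a
-- leaf, and v₂, v₃ have one neighbour each that is already off cycles), so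
-- every cycle is a cycle of T; and every vertex reaches the old vertex u.
module ExtensionTree {n} (T : Graph n) (u : Fin n) where
  private
    E = extend T u
  open Extension T u using (v₁-neighbour; v₂-neighbours; v₃-neighbours)
  open Cycles E using (off-cycles)

  old : Fin n → Fin (3 + n)
  old i = 3 ↑ʳ i

  v₁-off : OffCycles E zero
  v₁-off = off-cycles zero one λ y a → inj₁ (v₁-neighbour y a)

  v₂-off : OffCycles E one
  v₂-off = off-cycles one two nbrs
    where
    nbrs : ∀ y → Adj E one y → y ≡ two ⊎ OffCycles E y
    nbrs y a with v₂-neighbours y a
    ... | inj₁ refl = inj₂ v₁-off
    ... | inj₂ y≡v₃ = inj₁ y≡v₃

  v₃-off : OffCycles E two
  v₃-off = off-cycles two (old u) nbrs
    where
    nbrs : ∀ y → Adj E two y → y ≡ old u ⊎ OffCycles E y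
    nbrs y a with v₃-neighbours y a
    ... | inj₁ refl = inj₂ v₂-off
    ... | inj₂ y≡u  = inj₁ y≡u

  cycle-old : ∀ c → Cycle E c → Σ (List (Fin n)) λ l → c ≡ map old l
  cycle-old c cycle = strip c (All.tabulate old-vertex)
    where
    old-vertex : ∀ {v} → v ∈ c → Σ (Fin n) λ i → v ≡ old i
    old-vertex {zero} v∈c = ⊥-elim (v₁-off c cycle v∈c)
    old-vertex {one}  v∈c = ⊥-elim (v₂-off c cycle v∈c)
    old-vertex {two}  v∈c = ⊥-elim (v₃-off c cycle v∈c)
    old-vertex {suc (suc (suc i))} _ = i , refl
    strip : ∀ c → All (λ v → Σ (Fin n) λ i → v ≡ old i) c → Σ (List (Fin n)) λ l → c ≡ map old l
    strip [] [] = [] , refl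
    strip (_ ∷ c) ((i , refl) ∷ rest) with strip c rest
    ... | l , refl = i ∷ l , refl

  chain-old : ∀ l → Chain E (map old l) → Chain T l
  chain-old []          _        = tt
  chain-old (_ ∷ [])    _        = tt
  chain-old (a ∷ b ∷ l) (ab , c) = ab , chain-old (b ∷ l) c

  cycle-restrict : ∀ x xs → Cycle E (map old (x ∷ xs)) → Cycle T (x ∷ xs)
  cycle-restrict x xs (unique , long , chain) =
    map⁻ unique , subst (2 ≤_) (length-map old xs) long ,
    chain-old ((x ∷ xs) ∷ʳ x) (subst (Chain E) (sym (map-++ old (x ∷ xs) [ x ])) chain)

  extend-acyclic : ¬ HasCycle T → ¬ HasCycle E
  extend-acyclic acyclic (x , xs , cycle) with cycle-old (x ∷ xs) cycle
  ... | x′ ∷ xs′ , refl = acyclic (x′ , xs′ , cycle-restrict x′ xs′ cycle)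

  lift-walk : ∀ {a b} → Walk T a b → Walk E (old a) (old b)
  lift-walk here       = here
  lift-walk (step p w) = step p (lift-walk w)

  extend-connected : Connected T → Connected E
  extend-connected connected = connected-via E (old u) to-u
    where
    u-v₃ : Adj E two (old u)
    u-v₃ = dec-true (u ≟ u) refl
    to-u : ∀ x → Walk E x (old u)
    to-u zero = step {j = one} refl (step {j = two} refl (step u-v₃ here))
    to-u one  = step {j = two} refl (step u-v₃ here)
    to-u two  = step u-v₃ here
    to-u (suc (suc (suc i))) = lift-walk (connected i u)

  extend-tree : IsTree T → IsTree E
  extend-tree (connected , acyclic) = extend-connected connected , extend-acyclic acyclic

lemma4 : ∀ {m} (T : Graph (ℕ.suc m)) (u : Fin (ℕ.suc m)) →
    IsTree T → PRDStable T → InW T u →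
    IsTree (extend T u) × PRDStable (extend T u)
lemma4 T u tree stable u∈W = ExtensionTree.extend-tree T u tree , extend-stable T u stable u∈W
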